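{- Let $w=w_1\dots w_n$ be a word on positive integers, let $u=u_1\dots u_n=\mathrm{Park}(w)$, and let $U_1,\dots,U_k$ be the prime blocks of $u$ with position sets $P_1,\dots,P_k$. For each $i\in[k]$ let $d_i=w_p-u_p$ where $p$ is the smallest element of $P_i$. Then $d_i\ge0$, $w_q-u_q=d_i$ for every $q\in P_i$, and $d_1\le d_2\le\dots\le d_k$.
   Context: A word $u=u_1\dots u_n$ on positive integers is a parking function if its nondecreasing rearrangement $u'_1\le\dots\le u'_n$ satisfies $u'_i\le i$ for all $i$. Parkization: for $w=w_1\dots w_n$ let $d(w)=\min\{i\ge1:\#\{j:w_j\le i\}<i\}$; if $d(w)=n+1$ then $\mathrm{Park}(w)=w$, otherwise $\mathrm{Park}(w)=\mathrm{Park}(w')$ where $w'$ is obtained from $w$ by decreasing by one every letter greater than $d(w)$. Prime blocks: for a parking function $u$ of length $n$ with nondecreasing rearrangement $u'$, let $c_1=1<c_2<\dots<c_k$ be $1$ together with the indices $i\ge2$ such that $u'_i=i$, and $c_{k+1}=n+1$; let $V_j=\{u'_i: c_j\le i<c_{j+1}\}$. The prime blocks $U_1,\dots,U_k$ of $u$ are the subwords of $u$ consisting of the letters lying in $V_1,\dots,V_k$ respectively, and $P_j$ is the set of positions in $u$ of the letters of $U_j$. -}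

module Defs where

open import Data.Bool using (Bool; if_then_else_; _∨_)
open import Data.Nat using (ℕ; zero; suc; pred; _≤_; _<_; _≤?_; _<ᵇ_; _≡ᵇ_)
open import Data.Fin as F using (Fin; toℕ)
open import Data.Vec as V using (Vec; lookup; toList)
open import Data.List as L using (List; []; _∷_)
open import Data.Integer as ℤ using (ℤ; +_; _-_)
open import Data.Product using (Σ; ∃; _×_; _,_; proj₁; proj₂)
open import Relation.Nullary using (¬_)
open import Relation.Binary.PropositionalEquality using (_≡_)
open import Data.List.Relation.Binary.Permutation.Propositional using (_↭_)

-- Words of length n are vectors of naturals; positions are Fin n (0-based,
-- position q corresponds to the paper's 1-based index toℕ q + 1).

countLe : ∀ {n} → Vec ℕ n → ℕ → ℕ
countLe w i = V.count (_≤? i) w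

IsD : ∀ {n} → Vec ℕ n → ℕ → Set
IsD w i = (1 ≤ i) × (countLe w i < i)
        × (∀ j → 1 ≤ j → j < i → ¬ (countLe w j < j))

decr : ∀ {n} → ℕ → Vec ℕ n → Vec ℕ n
decr d = V.map (λ x → if d <ᵇ x then pred x else x)

-- Park w u : u = Park(w)  (graph of the recursively defined parkization map)
data Park {n : ℕ} : Vec ℕ n → Vec ℕ n → Set where
  done : ∀ {w} → IsD w (suc n) → Park w w
  step : ∀ {w u i} → IsD w i → ¬ (i ≡ suc n) → Park (decr i w) u → Park w u

SortedRearr : ∀ {n} → Vec ℕ n → Vec ℕ n → Set
SortedRearr {n} u u' = (toList u ↭ toList u')
  × (∀ (i j : Fin n) → toℕ i ≤ toℕ j → lookup u' i ≤ lookup u' j)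

-- (0-based) sorted position i is a block start: i is the first position, or
-- the 1-based index i+1 satisfies u'_{i+1} = i+1
isStartᵇ : ∀ {n} → Vec ℕ n → Fin n → Bool
isStartᵇ u' i = (toℕ i ≡ᵇ 0) ∨ (lookup u' i ≡ᵇ suc (toℕ i))

-- block intervals [c_j, c_{j+1}) (0-based), the last one ending at n
intervals : ∀ {n} → List (Fin n) → List (ℕ × ℕ)
intervals [] = []
intervals {n} (x ∷ []) = (toℕ x , n) ∷ []
intervals (x ∷ y ∷ r) = (toℕ x , toℕ y) ∷ intervals (y ∷ r)

blocks : ∀ {n} → Vec ℕ n → List (ℕ × ℕ)
blocks {n} u' = intervals (L.filterᵇ (isStartᵇ u') (L.allFin n))

numBlocks : ∀ {n} → Vec ℕ n → ℕ
numBlocks u' = L.length (blocks u')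

InV : ∀ {n} (u' : Vec ℕ n) → Fin (numBlocks u') → ℕ → Set
InV {n} u' j v = Σ (Fin n) λ i → (proj₁ (L.lookup (blocks u') j) ≤ toℕ i)
  × (toℕ i < proj₂ (L.lookup (blocks u') j)) × (lookup u' i ≡ v)

InP : ∀ {n} (u u' : Vec ℕ n) → Fin (numBlocks u') → Fin n → Set
InP u u' j q = InV u' j (lookup u q)

IsMinP : ∀ {n} (u u' : Vec ℕ n) → Fin (numBlocks u') → Fin n → Set
IsMinP {n} u u' j p = InP u u' j p × (∀ (q : Fin n) → InP u u' j q → toℕ p ≤ toℕ q)

diff : ∀ {n} → Vec ℕ n → Vec ℕ n → Fin n → ℤ
diff w u q = + lookup w q - + lookup u q

-- Put w_q = u_q + o_q with offsets o_q = w_q - u_q ≥ 0. One parkization step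
-- at d = d(w) lowers exactly the letters > d by one, so along the whole
-- parkization o_q is weakly increasing in w_q, and two positions q, q' with
-- w_q ≤ w_q' receive different offsets only because some step at d = m + 1
-- separated them, at a moment when exactly m letters were ≤ m. Such a cut m
-- survives to u, with u_q ≤ m < u_q'. But a cut c of the parking function u
-- (exactly c letters ≤ c) is a block boundary, u'_{c+1} = c + 1, so it never
-- lies between a letter of one block and a larger letter of an earlier or the
-- same block. Hence offsets cannot decrease along the block order, and in
-- particular are constant on every block.
module Submission where

open import Defs
open import Data.Bool using (true; false; if_then_else_)
open import Data.Bool.Properties using (T-∨)
open import Data.Fin as F using (Fin; toℕ; fromℕ<)
open import Data.Fin.Properties using (toℕ-fromℕ<; toℕ<n)
open import Data.Integer as ℤ using (+_)
import Data.Integer.Properties as ℤₚ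
open import Data.List as L using (List; []; _∷_)
open import Data.List.Membership.Propositional using (_∈_)
open import Data.List.Membership.Propositional.Properties using (∈-allFin; ∈-filter⁺)
open import Data.List.Relation.Binary.Permutation.Propositional using (_↭_)
open import Data.List.Relation.Binary.Permutation.Propositional.Properties using (filter-↭; ↭-length)
open import Data.List.Relation.Unary.All as All using (All)
open import Data.List.Relation.Unary.AllPairs using (AllPairs; []; _∷_)
import Data.List.Relation.Unary.AllPairs.Properties as AllPairs
open import Data.List.Relation.Unary.Any using (here; there)
open import Data.Nat
open import Data.Nat.Properties
open import Data.Product using (∃-syntax; _×_; _,_; proj₁; proj₂)
open import Data.Sum using (inj₁; inj₂)
open import Data.Vec as V using (Vec; lookup; toList; _∷_; [])
open import Data.Vec.Properties using (lookup-map)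
open import Function using (_∘_)
open import Function.Bundles using (Equivalence)
open import Level using (Level)
open import Relation.Nullary using (¬_; yes; no; contradiction)
open import Relation.Nullary.Reflects using (ofʸ; ofⁿ)
open import Relation.Unary using (Pred; Decidable)
open import Relation.Binary.PropositionalEquality

module _ {a p q : Level} {A : Set a} {P : Pred A p} {Q : Pred A q}
         (P? : Decidable P) (Q? : Decidable Q) where

  count-mono : ∀ {n} (v v' : Vec A n) → (∀ i → P (lookup v i) → Q (lookup v' i))
    → V.count P? v ≤ V.count Q? v'
  count-mono [] [] _ = z≤n
  count-mono (x ∷ xs) (y ∷ ys) P⇒Q with P? x | Q? y
  ... | yes _  | yes _  = s≤s (count-mono xs ys (P⇒Q ∘ F.suc))
  ... | yes px | no ¬qy = contradiction (P⇒Q F.zero px) ¬qy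
  ... | no _   | yes _  = m≤n⇒m≤1+n (count-mono xs ys (P⇒Q ∘ F.suc))
  ... | no _   | no _   = count-mono xs ys (P⇒Q ∘ F.suc)

  count-< : ∀ {n} (v v' : Vec A n) → (∀ i → P (lookup v i) → Q (lookup v' i))
    → ∀ i₀ → ¬ P (lookup v i₀) → Q (lookup v' i₀) → V.count P? v < V.count Q? v'
  count-< (x ∷ xs) (y ∷ ys) P⇒Q F.zero ¬px qy with P? x | Q? y
  ... | yes px | _      = contradiction px ¬px
  ... | no _   | no ¬qy = contradiction qy ¬qy
  ... | no _   | yes _  = s≤s (count-mono xs ys (P⇒Q ∘ F.suc))
  count-< (x ∷ xs) (y ∷ ys) P⇒Q (F.suc i₀) ¬p q with P? x | Q? y
  ... | yes _  | yes _  = s≤s (count-< xs ys (P⇒Q ∘ F.suc) i₀ ¬p q)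
  ... | yes px | no ¬qy = contradiction (P⇒Q F.zero px) ¬qy
  ... | no _   | yes _  = m≤n⇒m≤1+n (count-< xs ys (P⇒Q ∘ F.suc) i₀ ¬p q)
  ... | no _   | no _   = count-< xs ys (P⇒Q ∘ F.suc) i₀ ¬p q

module _ {a p : Level} {A : Set a} {P : Pred A p} (P? : Decidable P) where

  count-none : ∀ {n} (v : Vec A n) → (∀ i → ¬ P (lookup v i)) → V.count P? v ≡ 0
  count-none [] _ = refl
  count-none (x ∷ xs) ¬P with P? x
  ... | yes px = contradiction px (¬P F.zero)
  ... | no _   = count-none xs (¬P ∘ F.suc)

  count≡length∘filter : ∀ {n} (v : Vec A n) → V.count P? v ≡ L.length (L.filter P? (toList v))
  count≡length∘filter [] = refl
  count≡length∘filter (x ∷ xs) with P? x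
  ... | yes _ = cong suc (count≡length∘filter xs)
  ... | no _  = count≡length∘filter xs

countLe-↭ : ∀ {n} {u u' : Vec ℕ n} → toList u ↭ toList u' → ∀ c → countLe u c ≡ countLe u' c
countLe-↭ {u = u} {u'} u↭u' c = begin
  countLe u c                                  ≡⟨ count≡length∘filter (_≤? c) u ⟩
  L.length (L.filter (_≤? c) (toList u))       ≡⟨ ↭-length (filter-↭ (_≤? c) u↭u') ⟩
  L.length (L.filter (_≤? c) (toList u'))      ≡⟨ count≡length∘filter (_≤? c) u' ⟨
  countLe u' c                                 ∎
  where open ≡-Reasoning

countLe-mono : ∀ {n} (w : Vec ℕ n) {c c'} → c ≤ c' → countLe w c ≤ countLe w c'
countLe-mono w c≤c' = count-mono (_≤? _) (_≤? _) w w (λ _ h → ≤-trans h c≤c')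

Sorted : ∀ {n} → Vec ℕ n → Set
Sorted {n} v = ∀ (i j : Fin n) → toℕ i ≤ toℕ j → lookup v i ≤ lookup v j

Sorted-tail : ∀ {n x} {v : Vec ℕ n} → Sorted (x ∷ v) → Sorted v
Sorted-tail sorted i j i≤j = sorted (F.suc i) (F.suc j) (s≤s i≤j)

lookup≤⇒<countLe : ∀ {n} (v : Vec ℕ n) → Sorted v → ∀ {x} (k : Fin n)
  → lookup v k ≤ x → toℕ k < countLe v x
lookup≤⇒<countLe (y ∷ ys) sorted {x} k vk≤x with y ≤ᵇ x | ≤ᵇ-reflects-≤ y x
lookup≤⇒<countLe (y ∷ ys) sorted F.zero _ | true | _ = s≤s z≤n
lookup≤⇒<countLe (y ∷ ys) sorted (F.suc k) vk≤x | true | _ =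
  s≤s (lookup≤⇒<countLe ys (Sorted-tail sorted) k vk≤x)
lookup≤⇒<countLe (y ∷ ys) sorted k vk≤x | false | ofⁿ y≰x =
  contradiction (≤-trans (sorted F.zero k z≤n) vk≤x) y≰x

<lookup⇒countLe≤ : ∀ {n} (v : Vec ℕ n) → Sorted v → ∀ {x} (k : Fin n)
  → x < lookup v k → countLe v x ≤ toℕ k
<lookup⇒countLe≤ (y ∷ ys) sorted {x} k x<vk with y ≤ᵇ x | ≤ᵇ-reflects-≤ y x
<lookup⇒countLe≤ (y ∷ ys) sorted F.zero x<y | true | ofʸ y≤x = contradiction y≤x (<⇒≱ x<y)
<lookup⇒countLe≤ (y ∷ ys) sorted (F.suc k) x<vk | true | _ =
  s≤s (<lookup⇒countLe≤ ys (Sorted-tail sorted) k x<vk)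
<lookup⇒countLe≤ (y ∷ ys) sorted {x} F.zero x<y | false | _ = ≤-reflexive
  (count-none (_≤? x) ys (λ i → <⇒≱ (<-≤-trans x<y (sorted F.zero (F.suc i) z≤n))))
<lookup⇒countLe≤ (y ∷ ys) sorted (F.suc k) x<vk | false | _ =
  m≤n⇒m≤1+n (<lookup⇒countLe≤ ys (Sorted-tail sorted) k x<vk)

-- ParkedUpTo c w says that d(w) > c; a word of length n is a parking function
-- iff it is ParkedUpTo n.
ParkedUpTo : ∀ {n} → ℕ → Vec ℕ n → Set
ParkedUpTo c w = ∀ j → 1 ≤ j → j ≤ c → j ≤ countLe w j

CutBetween : ∀ {n} → Vec ℕ n → ℕ → ℕ → Set
CutBetween v a b = ∃[ c ] a ≤ c × c < b × countLe v c ≡ c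

ParkedUpTo⇒≤countLe : ∀ {n c} (w : Vec ℕ n) → ParkedUpTo c w → c ≤ countLe w c
ParkedUpTo⇒≤countLe {c = zero} _ _ = z≤n
ParkedUpTo⇒≤countLe {c = suc c} _ parked = parked (suc c) (s≤s z≤n) ≤-refl

ParkedUpTo-↭ : ∀ {n c} {u u' : Vec ℕ n} → toList u ↭ toList u' → ParkedUpTo c u → ParkedUpTo c u'
ParkedUpTo-↭ u↭u' parked j 1≤j j≤c = subst (j ≤_) (countLe-↭ u↭u' j) (parked j 1≤j j≤c)

IsD⇒ParkedUpTo : ∀ {n c} (w : Vec ℕ n) → IsD w (suc c) → ParkedUpTo c w
IsD⇒ParkedUpTo _ (_ , _ , minimal) j 1≤j j≤c = ≮⇒≥ (minimal j 1≤j (s≤s j≤c))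

IsD∧ParkedUpTo⇒< : ∀ {n c d} (w : Vec ℕ n) → IsD w d → ParkedUpTo c w → c < d
IsD∧ParkedUpTo⇒< _ (1≤d , deficit , _) parked = ≰⇒> (λ d≤c → <⇒≱ deficit (parked _ 1≤d d≤c))

IsD⇒cut : ∀ {n m} (w : Vec ℕ n) → IsD w (suc m) → countLe w m ≡ m
IsD⇒cut {m = m} w D@(_ , deficit , _) = ≤-antisym
  (s≤s⁻¹ (≤-<-trans (countLe-mono w (n≤1+n m)) deficit))
  (ParkedUpTo⇒≤countLe w (IsD⇒ParkedUpTo w D))

IsD⇒lookup≢ : ∀ {n m} (w : Vec ℕ n) → IsD w (suc m) → ∀ q → lookup w q ≢ suc m
IsD⇒lookup≢ {m = m} w D@(_ , deficit , _) q wq≡d = <⇒≱ more-below-d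
  (≤-trans (s≤s⁻¹ deficit) (ParkedUpTo⇒≤countLe w (IsD⇒ParkedUpTo w D)))
  where
  more-below-d : countLe w m < countLe w (suc m)
  more-below-d = count-< (_≤? m) (_≤? suc m) w w (λ _ → m≤n⇒m≤1+n) q
    (λ wq≤m → 1+n≰n (subst (_≤ m) wq≡d wq≤m)) (≤-reflexive wq≡d)

cut⇒lookup≡suc : ∀ {n} (v : Vec ℕ n) → ParkedUpTo n v → Sorted v → (k : Fin n)
  → countLe v (toℕ k) ≡ toℕ k → lookup v k ≡ suc (toℕ k)
cut⇒lookup≡suc v parked sorted k cut = ≤-antisym vk≤1+k k<vk
  where
  k<vk : toℕ k < lookup v k
  k<vk = ≰⇒> (λ vk≤k → <-irrefl (sym cut) (lookup≤⇒<countLe v sorted k vk≤k))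
  vk≤1+k : lookup v k ≤ suc (toℕ k)
  vk≤1+k = ≮⇒≥ (λ 1+k<vk → <-irrefl refl
    (≤-trans (parked (suc (toℕ k)) (s≤s z≤n) (toℕ<n k)) (<lookup⇒countLe≤ v sorted k 1+k<vk)))

module _ {n : ℕ} where

  start end : (l : List (Fin n)) → Fin (L.length (intervals l)) → ℕ
  start l j = proj₁ (L.lookup (intervals l) j)
  end l j = proj₂ (L.lookup (intervals l) j)

  start∈ : ∀ l j → ∃[ y ] y ∈ l × toℕ y ≡ start l j
  start∈ (x ∷ []) F.zero = x , here refl , refl
  start∈ (x ∷ y ∷ r) F.zero = x , here refl , refl
  start∈ (x ∷ y ∷ r) (F.suc j) with start∈ (y ∷ r) j
  ... | z , z∈ , eq = z , there z∈ , eq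

  head≤start : ∀ {x r} → All (x F.≤_) r → ∀ j → toℕ x ≤ start (x ∷ r) j
  head≤start {x} {r} x≤r j with start∈ (x ∷ r) j
  ... | _ , here refl , eq = ≤-reflexive eq
  ... | _ , there z∈r , eq = subst (toℕ x ≤_) eq (All.lookup x≤r z∈r)

  start-mono : ∀ {l} → AllPairs F._≤_ l → ∀ {j j'} → toℕ j ≤ toℕ j' → start l j ≤ start l j'
  start-mono {x ∷ []} _ {F.zero} {F.zero} _ = ≤-refl
  start-mono {x ∷ y ∷ r} (x≤ ∷ _) {F.zero} {j'} _ = head≤start x≤ j'
  start-mono {x ∷ y ∷ r} (_ ∷ sorted) {F.suc j} {F.suc j'} (s≤s j≤j') = start-mono sorted j≤j'

  ∈∧<end⇒≤start : ∀ {l} → AllPairs F._≤_ l → ∀ j {z} → z ∈ l → toℕ z < end l j → toℕ z ≤ start l j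
  ∈∧<end⇒≤start {x ∷ []} _ F.zero (here refl) _ = ≤-refl
  ∈∧<end⇒≤start {x ∷ y ∷ r} _ F.zero (here refl) _ = ≤-refl
  ∈∧<end⇒≤start {x ∷ y ∷ r} _ F.zero (there (here refl)) y<y = contradiction y<y (<-irrefl refl)
  ∈∧<end⇒≤start {x ∷ y ∷ r} (_ ∷ (y≤r ∷ _)) F.zero (there (there z∈r)) z<y =
    contradiction (All.lookup y≤r z∈r) (<⇒≱ z<y)
  ∈∧<end⇒≤start {x ∷ y ∷ r} (x≤ ∷ _) (F.suc j) (here refl) _ = head≤start x≤ (F.suc j)
  ∈∧<end⇒≤start {x ∷ y ∷ r} (_ ∷ sorted) (F.suc j) (there z∈) z<end = ∈∧<end⇒≤start sorted j z∈ z<end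

  starts : Vec ℕ n → List (Fin n)
  starts v = L.filterᵇ (isStartᵇ v) (L.allFin n)

  starts-sorted : ∀ v → AllPairs F._≤_ (starts v)
  starts-sorted v = AllPairs.filter⁺ _ (AllPairs.tabulate⁺-< <⇒≤)

  lookup≡suc⇒∈starts : ∀ v k → lookup v k ≡ suc (toℕ k) → k ∈ starts v
  lookup≡suc⇒∈starts _ k eq = ∈-filter⁺ _ (∈-allFin k) (Equivalence.from T-∨ (inj₂ (≡⇒≡ᵇ _ _ eq)))

block-order-no-cut : ∀ {n} {u u' : Vec ℕ n} → ParkedUpTo n u → SortedRearr u u'
  → ∀ {j j' a b} → toℕ j ≤ toℕ j' → InV u' j a → InV u' j' b → ¬ CutBetween u b a
block-order-no-cut {n} {u} {u'} parked (u↭u' , sorted) {j} {j'} j≤j'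
  (i , _ , i<end , refl) (i' , start≤i' , _ , refl) (c , b≤c , c<a , cut) =
  -- the cut c is a block start at a sorted position after b's and not after a's
  <-irrefl refl (begin-strict
    start (starts u') j'   ≤⟨ start≤i' ⟩
    toℕ i'                 <⟨ i'<c ⟩
    c                      ≤⟨ c≤start ⟩
    start (starts u') j    ≤⟨ start-mono (starts-sorted u') j≤j' ⟩
    start (starts u') j'   ∎)
  where
  open ≤-Reasoning hiding (start)
  cut' : countLe u' c ≡ c
  cut' = trans (sym (countLe-↭ u↭u' c)) cut
  i'<c : toℕ i' < c
  i'<c = subst (toℕ i' <_) cut' (lookup≤⇒<countLe u' sorted i' b≤c)
  c≤i : c ≤ toℕ i
  c≤i = subst (_≤ toℕ i) cut' (<lookup⇒countLe≤ u' sorted i c<a)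
  k : Fin n
  k = fromℕ< (≤-<-trans c≤i (toℕ<n i))
  k≡c : toℕ k ≡ c
  k≡c = toℕ-fromℕ< _
  k∈starts : k ∈ starts u'
  k∈starts = lookup≡suc⇒∈starts u' k (cut⇒lookup≡suc u' (ParkedUpTo-↭ u↭u' parked) sorted k
    (subst (λ m → countLe u' m ≡ m) (sym k≡c) cut'))
  c≤start : c ≤ start (starts u') j
  c≤start = subst (_≤ start (starts u') j) k≡c (∈∧<end⇒≤start (starts-sorted u') j k∈starts
    (subst (_< end (starts u') j) (sym k≡c) (≤-<-trans c≤i i<end)))

shift : ℕ → ℕ → ℕ
shift d x = if d <ᵇ x then pred x else x

shift-kept : ∀ {d x} → x ≤ d → shift d x ≡ x
shift-kept {d} {x} x≤d with d <ᵇ x | <ᵇ-reflects-< d x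
... | false | _ = refl
... | true | ofʸ d<x = contradiction x≤d (<⇒≱ d<x)

shift-moved : ∀ {d x} → d < x → suc (shift d x) ≡ x
shift-moved {d} {suc x} d<x with d <ᵇ suc x | <ᵇ-reflects-< d (suc x)
... | true | _ = refl
... | false | ofⁿ d≮x = contradiction d<x d≮x

module _ {n : ℕ} (d : ℕ) (w : Vec ℕ n) where

  decr-kept : ∀ q → lookup w q ≤ d → lookup (decr d w) q ≡ lookup w q
  decr-kept q h = trans (lookup-map q (shift d) w) (shift-kept h)

  decr-moved : ∀ q → d < lookup w q → suc (lookup (decr d w) q) ≡ lookup w q
  decr-moved q h = trans (cong suc (lookup-map q (shift d) w)) (shift-moved h)

  decr-≥ : ∀ q → d < lookup w q → d ≤ lookup (decr d w) q
  decr-≥ q h = s≤s⁻¹ (subst (d <_) (sym (decr-moved q h)) h)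

  decr-≤ : ∀ q → lookup (decr d w) q ≤ lookup w q
  decr-≤ q with ≤-<-connex (lookup w q) d
  ... | inj₁ h = ≤-reflexive (decr-kept q h)
  ... | inj₂ h = subst (lookup (decr d w) q ≤_) (decr-moved q h) (n≤1+n _)

  decr-mono : ∀ q q' → lookup w q ≤ lookup w q' → lookup (decr d w) q ≤ lookup (decr d w) q'
  decr-mono q q' h with ≤-<-connex (lookup w q) d | ≤-<-connex (lookup w q') d
  ... | inj₁ a | inj₁ b = subst₂ _≤_ (sym (decr-kept q a)) (sym (decr-kept q' b)) h
  ... | inj₁ a | inj₂ b = ≤-trans (≤-reflexive (decr-kept q a)) (≤-trans a (decr-≥ q' b))
  ... | inj₂ a | inj₁ b = contradiction (≤-trans h b) (<⇒≱ a)
  ... | inj₂ a | inj₂ b = s≤s⁻¹ (subst₂ _≤_ (sym (decr-moved q a)) (sym (decr-moved q' b)) h)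

  countLe-decr : ∀ {j} → j < d → countLe (decr d w) j ≡ countLe w j
  countLe-decr {j} j<d = ≤-antisym
    (count-mono (_≤? j) (_≤? j) (decr d w) w lowered⇒low)
    (count-mono (_≤? j) (_≤? j) w (decr d w) (λ q h → ≤-trans (decr-≤ q) h))
    where
    lowered⇒low : ∀ q → lookup (decr d w) q ≤ j → lookup w q ≤ j
    lowered⇒low q h with ≤-<-connex (lookup w q) d
    ... | inj₁ wq≤d = subst (_≤ j) (decr-kept q wq≤d) h
    ... | inj₂ d<wq = contradiction (≤-trans (decr-≥ q d<wq) h) (<⇒≱ j<d)

  ParkedUpTo-decr : ∀ {c} → c < d → ParkedUpTo c w → ParkedUpTo c (decr d w)
  ParkedUpTo-decr c<d parked j 1≤j j≤c =
    subst (j ≤_) (sym (countLe-decr (≤-<-trans j≤c c<d))) (parked j 1≤j j≤c)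

park-isD : ∀ {n} {w u : Vec ℕ n} → Park w u → IsD u (suc n)
park-isD (done D) = D
park-isD (step _ _ P) = park-isD P

park-≤ : ∀ {n} {w u : Vec ℕ n} → Park w u → ∀ q → lookup u q ≤ lookup w q
park-≤ (done _) q = ≤-refl
park-≤ {w = w} (step {i = d} _ _ P) q = ≤-trans (park-≤ P q) (decr-≤ d w q)

module _ {n c : ℕ} where

  park-fixes-low : ∀ {w u : Vec ℕ n} → Park w u → ParkedUpTo c w
    → ∀ q → lookup w q ≤ c → lookup u q ≡ lookup w q
  park-fixes-low (done _) _ _ _ = refl
  park-fixes-low {w} (step {i = d} D _ P) parked q wq≤c with ≤-<-connex (lookup w q) d
  ... | inj₁ wq≤d = trans
    (park-fixes-low P (ParkedUpTo-decr d w c<d parked) q (subst (_≤ c) (sym (decr-kept d w q wq≤d)) wq≤c))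
    (decr-kept d w q wq≤d)
    where c<d = IsD∧ParkedUpTo⇒< w D parked
  ... | inj₂ d<wq = contradiction (≤-trans wq≤c (<⇒≤ (IsD∧ParkedUpTo⇒< w D parked))) (<⇒≱ d<wq)

  park-keeps-high : ∀ {w u : Vec ℕ n} → Park w u → ParkedUpTo c w
    → ∀ q → c < lookup w q → c < lookup u q
  park-keeps-high (done _) _ _ c<wq = c<wq
  park-keeps-high {w} (step {i = d} D _ P) parked q c<wq =
    park-keeps-high P (ParkedUpTo-decr d w c<d parked) q c<w'q
    where
    c<d = IsD∧ParkedUpTo⇒< w D parked
    c<w'q : c < lookup (decr d w) q
    c<w'q with ≤-<-connex (lookup w q) d
    ... | inj₁ wq≤d = subst (c <_) (sym (decr-kept d w q wq≤d)) c<wq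
    ... | inj₂ d<wq = <-≤-trans c<d (decr-≥ d w q d<wq)

  park-countLe : ∀ {w u : Vec ℕ n} → Park w u → ParkedUpTo c w → countLe u c ≡ countLe w c
  park-countLe (done _) _ = refl
  park-countLe {w} (step {i = d} D _ P) parked =
    trans (park-countLe P (ParkedUpTo-decr d w c<d parked)) (countLe-decr d w c<d)
    where c<d = IsD∧ParkedUpTo⇒< w D parked

  park-cut : ∀ {w u : Vec ℕ n} → Park w u → ParkedUpTo c w → countLe w c ≡ c
    → ∀ q q' → lookup w q ≤ c → c < lookup w q' → CutBetween u (lookup u q) (lookup u q')
  park-cut P parked cut q q' wq≤c c<wq' =
    c , subst (_≤ c) (sym (park-fixes-low P parked q wq≤c)) wq≤c
      , park-keeps-high P parked q' c<wq'
      , trans (park-countLe P parked) cut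

-- With d = d(w) = m + 1, exactly m letters of w are ≤ m and none equals d.
park-step-cut : ∀ {n d} (w : Vec ℕ n) {u} → IsD w d → Park (decr d w) u
  → ∀ q q' → lookup w q ≤ d → d < lookup w q' → CutBetween u (lookup u q) (lookup u q')
park-step-cut {d = zero} _ (() , _) _ _ _ _ _
park-step-cut {d = suc m} w D P q q' wq≤d d<wq' =
  park-cut P (ParkedUpTo-decr (suc m) w ≤-refl (IsD⇒ParkedUpTo w D))
    (trans (countLe-decr (suc m) w ≤-refl) (IsD⇒cut w D)) q q'
    (subst (_≤ m) (sym (decr-kept (suc m) w q wq≤d)) (s≤s⁻¹ (≤∧≢⇒< wq≤d (IsD⇒lookup≢ w D q))))
    (decr-≥ (suc m) w q' d<wq')

offset : ∀ {n} → Vec ℕ n → Vec ℕ n → Fin n → ℕ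
offset w u q = lookup w q ∸ lookup u q

module _ {n : ℕ} (d : ℕ) (w u : Vec ℕ n) (q : Fin n) where

  offset-kept : lookup w q ≤ d → offset (decr d w) u q ≡ offset w u q
  offset-kept h = cong (_∸ lookup u q) (decr-kept d w q h)

  offset-moved : d < lookup w q → lookup u q ≤ lookup (decr d w) q
    → offset w u q ≡ suc (offset (decr d w) u q)
  offset-moved h u≤ = trans (cong (_∸ lookup u q) (sym (decr-moved d w q h))) (+-∸-assoc 1 u≤)

park-offset-mono : ∀ {n} {w u : Vec ℕ n} → Park w u
  → ∀ q q' → lookup w q ≤ lookup w q' → offset w u q ≤ offset w u q'
park-offset-mono {w = w} (done _) q q' _ =
  ≤-reflexive (trans (n∸n≡0 (lookup w q)) (sym (n∸n≡0 (lookup w q'))))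
park-offset-mono {w = w} {u} (step {i = d} _ _ P) q q' h
  with ≤-<-connex (lookup w q) d | ≤-<-connex (lookup w q') d
... | inj₁ a | inj₁ b = subst₂ _≤_ (offset-kept d w u q a) (offset-kept d w u q' b) ih
  where ih = park-offset-mono P q q' (decr-mono d w q q' h)
... | inj₁ a | inj₂ b = subst₂ _≤_ (offset-kept d w u q a)
  (sym (offset-moved d w u q' b (park-≤ P q'))) (m≤n⇒m≤1+n ih)
  where ih = park-offset-mono P q q' (decr-mono d w q q' h)
... | inj₂ a | inj₁ b = contradiction (≤-trans h b) (<⇒≱ a)
... | inj₂ a | inj₂ b = subst₂ _≤_ (sym (offset-moved d w u q a (park-≤ P q)))
  (sym (offset-moved d w u q' b (park-≤ P q'))) (s≤s ih)
  where ih = park-offset-mono P q q' (decr-mono d w q q' h)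

park-offset-jump : ∀ {n} {w u : Vec ℕ n} → Park w u
  → ∀ q q' → lookup w q ≤ lookup w q' → offset w u q < offset w u q'
  → CutBetween u (lookup u q) (lookup u q')
park-offset-jump {w = w} (done _) q q' _ lt =
  contradiction (subst₂ _<_ (n∸n≡0 (lookup w q)) (n∸n≡0 (lookup w q')) lt) (<-irrefl refl)
park-offset-jump {w = w} {u} (step {i = d} D _ P) q q' h lt
  with ≤-<-connex (lookup w q) d | ≤-<-connex (lookup w q') d
... | inj₁ a | inj₁ b = park-offset-jump P q q' (decr-mono d w q q' h)
  (subst₂ _<_ (sym (offset-kept d w u q a)) (sym (offset-kept d w u q' b)) lt)
... | inj₁ a | inj₂ b = park-step-cut w D P q q' a b
... | inj₂ a | inj₁ b = contradiction (≤-trans h b) (<⇒≱ a)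
... | inj₂ a | inj₂ b = park-offset-jump P q q' (decr-mono d w q q' h)
  (s<s⁻¹ (subst₂ _<_ (offset-moved d w u q a (park-≤ P q)) (offset-moved d w u q' b (park-≤ P q')) lt))

offset-<⇒cut : ∀ {n} {w u : Vec ℕ n} → Park w u
  → ∀ q q' → offset w u q < offset w u q' → CutBetween u (lookup u q) (lookup u q')
offset-<⇒cut {w = w} P q q' lt with ≤-total (lookup w q) (lookup w q')
... | inj₁ h = park-offset-jump P q q' h lt
... | inj₂ h = contradiction (park-offset-mono P q' q h) (<⇒≱ lt)

park-offset-block-mono : ∀ {n} {w u u' : Vec ℕ n} → Park w u → SortedRearr u u'
  → ∀ {j j'} p p' → toℕ j ≤ toℕ j' → InP u u' j p → InP u u' j' p' → offset w u p ≤ offset w u p'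
park-offset-block-mono {u = u} P sr p p' j≤j' p∈ p'∈ = ≮⇒≥ λ p'<p →
  block-order-no-cut (IsD⇒ParkedUpTo u (park-isD P)) sr j≤j' p∈ p'∈ (offset-<⇒cut P p' p p'<p)

diff≡offset : ∀ {n} (w u : Vec ℕ n) q → lookup u q ≤ lookup w q → diff w u q ≡ + offset w u q
diff≡offset w u q u≤w = trans (ℤₚ.m-n≡m⊖n (lookup w q) (lookup u q)) (ℤₚ.⊖-≥ u≤w)

mainTheorem8 : ∀ {n} (w u u' : Vec ℕ n) → (∀ (q : Fin n) → 1 ≤ lookup w q)
    → Park w u → SortedRearr u u'
    → ((j : Fin (numBlocks u')) (p : Fin n) → IsMinP u u' j p
        → (+ 0 ℤ.≤ diff w u p) × (∀ (q : Fin n) → InP u u' j q → diff w u q ≡ diff w u p))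
      × ((j j' : Fin (numBlocks u')) (p p' : Fin n) → toℕ j ≤ toℕ j'
        → IsMinP u u' j p → IsMinP u u' j' p' → diff w u p ℤ.≤ diff w u p')
mainTheorem8 w u u' _ P sr =
    (λ j p (p∈ , _) → subst (+ 0 ℤ.≤_) (sym (diff≡ p)) (ℤ.+≤+ z≤n)
                    , λ q q∈ → trans (diff≡ q) (trans (cong +_ (≤-antisym
                        (park-offset-block-mono P sr q p ≤-refl q∈ p∈)
                        (park-offset-block-mono P sr p q ≤-refl p∈ q∈))) (sym (diff≡ p))))
  , (λ j j' p p' j≤j' (p∈ , _) (p'∈ , _) → subst₂ ℤ._≤_ (sym (diff≡ p)) (sym (diff≡ p'))
      (ℤ.+≤+ (park-offset-block-mono P sr p p' j≤j' p∈ p'∈)))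
  where
  diff≡ : ∀ q → diff w u q ≡ + offset w u q
  diff≡ q = diff≡offset w u q (park-≤ P q)
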